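{- For every pair of integers $a,b$ with $2\leq a\leq b$, there exists a connected graph $G$ of some order $n$ such that $px_k(G)=a$ and $rx_k(G)=b$ for each integer $k$ with $3\leq k\leq n$.
   Context: All graphs are finite, simple, undirected and connected. An edge-coloring of a graph $G$ assigns colors to edges (adjacent edges may receive the same color). A tree in an edge-colored graph is a proper tree if any two adjacent edges of it receive different colors, and a rainbow tree if no two of its edges receive the same color. For $S\subseteq V(G)$, an $S$-tree is a tree in $G$ containing all vertices of $S$. For a graph $G$ of order $n$ and an integer $k$ with $2\leq k\leq n$, an edge-coloring of $G$ is a $k$-proper coloring (resp. $k$-rainbow coloring) if for every set $S$ of $k$ vertices of $G$ there is a proper (resp. rainbow) $S$-tree in $G$. The $k$-proper index $px_k(G)$ (resp. $k$-rainbow index $rx_k(G)$) of a nontrivial connected graph $G$ is the smallest number of colors in a $k$-proper (resp. $k$-rainbow) coloring of $G$. -}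

module Defs where

open import Data.Nat using (ℕ; _≤_; _<_; suc)
open import Data.Bool using (Bool; true; false)
open import Data.Fin using (Fin)
open import Data.Fin.Subset using (Subset; _∈_; _⊆_; ∣_∣)
open import Data.List using (List; []; _∷_; _++_; length)
open import Data.List.Relation.Unary.Linked using (Linked)
open import Data.List.Relation.Unary.Unique.Propositional using (Unique)
open import Data.Product using (Σ; _×_; ∃)
open import Data.Sum using (_⊎_)
open import Data.Empty using (⊥)
open import Relation.Nullary using (¬_)
open import Relation.Binary.PropositionalEquality using (_≡_; _≢_)
open import Relation.Binary.Construct.Closure.ReflexiveTransitive using (Star)

record Graph (n : ℕ) : Set where
  field
    adj    : Fin n → Fin n → Bool
    sym    : ∀ u v → adj u v ≡ adj v u
    irrefl : ∀ u → adj u u ≡ false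

open Graph public

Adj : ∀ {n} → Graph n → Fin n → Fin n → Set
Adj G u v = adj G u v ≡ true

Connected : ∀ {n} → Graph n → Set
Connected G = ∀ u v → Star (Adj G) u v

IsCycle : ∀ {n} → (Fin n → Fin n → Set) → List (Fin n) → Set
IsCycle R []       = ⊥
IsCycle R (v ∷ ws) = (2 ≤ length ws) × Unique (v ∷ ws) × Linked R (v ∷ ws ++ v ∷ [])

record Tree {n : ℕ} (G : Graph n) : Set where
  field
    vs      : Subset n
    es      : Fin n → Fin n → Bool
    es-sym  : ∀ u v → es u v ≡ es v u
    es-sub  : ∀ u v → es u v ≡ true → Adj G u v
    es-ends : ∀ u v → es u v ≡ true → u ∈ vs
    conn    : ∀ u v → u ∈ vs → v ∈ vs → Star (λ x y → es x y ≡ true) u v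
    acyclic : ∀ cs → ¬ IsCycle (λ x y → es x y ≡ true) cs

open Tree public

TE : ∀ {n} {G : Graph n} → Tree G → Fin n → Fin n → Set
TE T u v = es T u v ≡ true

record EdgeColoring {n : ℕ} (G : Graph n) (m : ℕ) : Set where
  field
    col     : Fin n → Fin n → Fin m
    col-sym : ∀ u v → col u v ≡ col v u

open EdgeColoring public

IsProperTree : ∀ {n m} {G : Graph n} → EdgeColoring G m → Tree G → Set
IsProperTree c T = ∀ u v w → TE T u v → TE T v w → u ≢ w → col c u v ≢ col c v w

IsRainbowTree : ∀ {n m} {G : Graph n} → EdgeColoring G m → Tree G → Set
IsRainbowTree c T = ∀ u v x y → TE T u v → TE T x y →
  ¬ ((u ≡ x × v ≡ y) ⊎ (u ≡ y × v ≡ x)) → col c u v ≢ col c x y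

IsSTree : ∀ {n} {G : Graph n} → Subset n → Tree G → Set
IsSTree S T = S ⊆ vs T

IsKProper : ∀ {n m} (k : ℕ) (G : Graph n) → EdgeColoring G m → Set
IsKProper {n} k G c = ∀ (S : Subset n) → ∣ S ∣ ≡ k →
  Σ (Tree G) λ T → IsSTree S T × IsProperTree c T

IsKRainbow : ∀ {n m} (k : ℕ) (G : Graph n) → EdgeColoring G m → Set
IsKRainbow {n} k G c = ∀ (S : Subset n) → ∣ S ∣ ≡ k →
  Σ (Tree G) λ T → IsSTree S T × IsRainbowTree c T

PxEq : ∀ {n} (k : ℕ) (G : Graph n) (a : ℕ) → Set
PxEq k G a = (Σ (EdgeColoring G a) λ c → IsKProper k G c)
           × (∀ m → m < a → ¬ Σ (EdgeColoring G m) λ c → IsKProper k G c)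

RxEq : ∀ {n} (k : ℕ) (G : Graph n) (b : ℕ) → Set
RxEq k G b = (Σ (EdgeColoring G b) λ c → IsKRainbow k G c)
           × (∀ m → m < b → ¬ Σ (EdgeColoring G m) λ c → IsKRainbow k G c)

-- The graph is a spider: the star with centre 0 and leaves 1, …, a, with the path a, a+1, …, b
-- attached at the leaf a, a tree with b edges and maximum degree a. Colouring every edge by its
-- endpoint farther from the root is rainbow with b colours; giving the leaf edges distinct colours
-- and alternating two of them along the path is proper with a colours. Conversely, the only edge
-- leaving the branch below a vertex c ≠ 0 joins c to its parent, so every tree meeting the branch
-- and its complement contains that edge. With fewer than a colours two leaf edges agree, and a
-- tree through both leaves is not proper; with fewer than b colours two edges agree, and a tree
-- through the root and their far endpoints is not rainbow.

module Submission where

open import Defs hiding (sym)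
open import Data.Bool using (Bool; true; false; _∨_)
open import Data.Bool.Properties using (∨-comm)
import Data.Fin as Fin
open import Data.Fin using (Fin; zero; suc; toℕ; fromℕ<; inject₁; inject≤; _≟_)
open import Data.Fin.Induction using (<-wellFounded)
open import Data.Fin.Properties
  using (toℕ-injective; toℕ<n; toℕ-fromℕ<; fromℕ<-injective; toℕ-inject₁; toℕ-inject≤;
         inject≤-injective; suc-injective; <⇒≢; pigeonhole)
open import Data.Fin.Subset using (Subset; inside; outside; _∈_; _⊆_; ∣_∣; _∪_; ⁅_⁆; ⊤)
  renaming (⊥ to ∅)
open import Data.Fin.Subset.Properties using (∣⊥∣≡0; ∣⁅x⁆∣≡1; ∣⊤∣≡n; ∈⊤; ⊆⊤; x∈⁅x⁆; p⊆p∪q; q⊆p∪q; s⊆s; out⊆)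
open import Data.List using (List; []; _∷_; _++_; length; foldr)
open import Data.Vec using ([]; _∷_)
open import Data.List.Relation.Unary.All as All using (All; []; _∷_)
open import Data.List.Relation.Unary.AllPairs using (_∷_)
open import Data.List.Relation.Unary.Linked as Linked using (Linked; _∷_)
open import Data.List.Relation.Unary.Unique.Propositional using (Unique)
open import Data.Nat using (ℕ; zero; suc; z≤n; s≤s; _+_; _⊔_; _≤_; _<_; _≤?_; _<?_)
open import Data.Nat.Properties
  using (≤-refl; ≤-trans; ≤-reflexive; ≤-antisym; ≤-pred; <-trans; <-irrefl; <-asym; <-≤-trans; ≮⇒≥; ≰⇒>;
         n≮0; n≤1+n; m≤n⇒m≤1+n; m≤n⇒m<n∨m≡n; +-suc; +-mono-≤; +-monoʳ-≤; ⊔-comm; ⊔-lub; m≤n⇒m⊔n≡n)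
open import Data.Product using (Σ; ∃₂; _×_; _,_; proj₁; proj₂)
import Data.Product as Product
open import Data.Sum using (_⊎_; inj₁; inj₂; map₁)
open import Function using (_∘_)
open import Induction.WellFounded using (Acc; acc)
open import Relation.Binary.Construct.Closure.ReflexiveTransitive using (Star; ε; _◅_; _◅◅_; reverse)
open import Relation.Binary.PropositionalEquality
  using (_≡_; _≢_; refl; sym; trans; cong; subst; subst₂; ≢-sym; module ≡-Reasoning)
open import Relation.Nullary using (¬_; Dec; yes; no; contradiction)
open import Relation.Nullary.Decidable using (⌊_⌋; _×-dec_; _⊎-dec_)
open import Relation.Unary using (Decidable)

crossing-step : ∀ {A : Set} {R : A → A → Set} {P : A → Set} → Decidable P →
                ∀ {u v} → Star R u v → P u → ¬ P v → ∃₂ λ x y → R x y × P x × ¬ P y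
crossing-step P? ε Pu ¬Pv = contradiction Pu ¬Pv
crossing-step P? {u} (_◅_ {j = w} r rs) Pu ¬Pv with P? w
... | yes Pw = crossing-step P? rs Pw ¬Pv
... | no ¬Pw = u , w , r , Pu , ¬Pw

Adj-sym : ∀ {n} (G : Graph n) {u v} → Adj G u v → Adj G v u
Adj-sym G {u} {v} e = trans (Graph.sym G v u) e

TE-sym : ∀ {n} {G : Graph n} (T : Tree G) {u v} → TE T u v → TE T v u
TE-sym T {u} {v} e = trans (es-sym T v u) e

SameEdge : {V : Set} → V → V → V → V → Set
SameEdge u v x y = (u ≡ x × v ≡ y) ⊎ (u ≡ y × v ≡ x)

toggle : ℕ → ℕ
toggle zero    = 1
toggle (suc _) = 0

toggle-≢ : ∀ n → toggle n ≢ n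
toggle-≢ zero    ()
toggle-≢ (suc n) ()

toggle≤1 : ∀ n → toggle n ≤ 1
toggle≤1 zero    = ≤-refl
toggle≤1 (suc n) = z≤n

∣p∪q∣≤∣p∣+∣q∣ : ∀ {n} (p q : Subset n) → ∣ p ∪ q ∣ ≤ ∣ p ∣ + ∣ q ∣
∣p∪q∣≤∣p∣+∣q∣ []            []            = z≤n
∣p∪q∣≤∣p∣+∣q∣ (inside  ∷ p) (inside  ∷ q) = s≤s (≤-trans (∣p∪q∣≤∣p∣+∣q∣ p q) (+-monoʳ-≤ ∣ p ∣ (n≤1+n ∣ q ∣)))
∣p∪q∣≤∣p∣+∣q∣ (inside  ∷ p) (outside ∷ q) = s≤s (∣p∪q∣≤∣p∣+∣q∣ p q)
∣p∪q∣≤∣p∣+∣q∣ (outside ∷ p) (inside  ∷ q) = ≤-trans (s≤s (∣p∪q∣≤∣p∣+∣q∣ p q)) (≤-reflexive (sym (+-suc ∣ p ∣ ∣ q ∣)))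
∣p∪q∣≤∣p∣+∣q∣ (outside ∷ p) (outside ∷ q) = ∣p∪q∣≤∣p∣+∣q∣ p q

extend-to-size : ∀ {n k} (S₀ : Subset n) → ∣ S₀ ∣ ≤ k → k ≤ n → Σ (Subset n) λ S → S₀ ⊆ S × ∣ S ∣ ≡ k
extend-to-size [] z≤n z≤n = [] , (λ x∈ → x∈) , refl
extend-to-size (inside ∷ S₀) (s≤s ∣S₀∣≤k) (s≤s k≤n) with S , S₀⊆S , ∣S∣≡k ← extend-to-size S₀ ∣S₀∣≤k k≤n =
  inside ∷ S , s⊆s S₀⊆S , cong suc ∣S∣≡k
extend-to-size {suc n} {k} (outside ∷ S₀) ∣S₀∣≤k k≤1+n with k ≤? n
... | yes k≤n with S , S₀⊆S , ∣S∣≡k ← extend-to-size S₀ ∣S₀∣≤k k≤n = outside ∷ S , out⊆ S₀⊆S , ∣S∣≡k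
... | no k≰n = ⊤ , ⊆⊤ , trans (∣⊤∣≡n (suc n)) (≤-antisym (≰⇒> k≰n) k≤1+n)

elements : ∀ {n} → List (Fin n) → Subset n
elements = foldr (λ x S → ⁅ x ⁆ ∪ S) ∅

∣elements∣≤length : ∀ {n} (xs : List (Fin n)) → ∣ elements xs ∣ ≤ length xs
∣elements∣≤length {n} []   = ≤-reflexive (∣⊥∣≡0 n)
∣elements∣≤length (x ∷ xs) =
  ≤-trans (∣p∪q∣≤∣p∣+∣q∣ ⁅ x ⁆ (elements xs)) (+-mono-≤ (≤-reflexive (∣⁅x⁆∣≡1 x)) (∣elements∣≤length xs))

∈-elements : ∀ {n} (xs : List (Fin n)) → All (_∈ elements xs) xs
∈-elements []       = []
∈-elements (x ∷ xs) = p⊆p∪q (elements xs) (x∈⁅x⁆ x) ∷ All.map (q⊆p∪q ⁅ x ⁆ (elements xs)) (∈-elements xs)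

superset-of-size : ∀ {n k} (xs : List (Fin n)) → length xs ≤ k → k ≤ n →
                   Σ (Subset n) λ S → All (_∈ S) xs × ∣ S ∣ ≡ k
superset-of-size xs ∣xs∣≤k k≤n
  with S , xs⊆S , ∣S∣≡k ← extend-to-size (elements xs) (≤-trans (∣elements∣≤length xs) ∣xs∣≤k) k≤n =
  S , All.map xs⊆S (∈-elements xs) , ∣S∣≡k

module ParentRelation {n : ℕ} (par : Fin n → Fin n) (rank : Fin n → ℕ) where

  private
    V : Set
    V = Fin n

  _ParentOf_ : V → V → Set
  x ParentOf y = x ≡ par y × rank x < rank y

  Step : V → V → Set
  Step x y = x ParentOf y ⊎ y ParentOf x

  module _ (v : V) where

    NonBacktracking : V → V → List V → Set
    NonBacktracking p q []       = p ≢ v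
    NonBacktracking p q (r ∷ ws) = p ≢ r × NonBacktracking q r ws

    penultimate : V → List V → V
    penultimate q []       = q
    penultimate q (r ∷ ws) = penultimate r ws

    All-penultimate : ∀ {P : V → Set} {q} ws → All P (q ∷ ws) → P (penultimate q ws)
    All-penultimate []       (Pq ∷ [])  = Pq
    All-penultimate (r ∷ ws) (_ ∷ Pws) = All-penultimate ws Pws

    -- Once a non-backtracking walk steps from a parent to a child it keeps doing so: the only other
    -- neighbour of a child is the parent it was entered from.
    ascending : ∀ {p q} ws → p ParentOf q → Linked Step (q ∷ ws ++ v ∷ []) → NonBacktracking p q ws →
                rank p < rank v × penultimate q ws ParentOf v
    ascending []       (_ , p<q)  (inj₁ qPv ∷ _)       _          = <-trans p<q (proj₂ qPv) , qPv
    ascending []       (p≡ , _)   (inj₂ (v≡ , _) ∷ _)  p≢v        = contradiction (trans p≡ (sym v≡)) p≢v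
    ascending (r ∷ ws) (_ , p<q)  (inj₁ qPr ∷ walk)    (_ , nb)   =
      Product.map₁ (<-trans p<q) (ascending ws qPr walk nb)
    ascending (r ∷ ws) (p≡ , _)   (inj₂ (r≡ , _) ∷ _)  (p≢r , _)  = contradiction (trans p≡ (sym r≡)) p≢r

    descending : ∀ {p q} ws → q ParentOf p → Linked Step (q ∷ ws ++ v ∷ []) → NonBacktracking p q ws →
                 rank v < rank p ⊎ penultimate q ws ParentOf v
    descending []       _         (inj₁ qPv ∷ _)     _        = inj₂ qPv
    descending []       (_ , q<p) (inj₂ vPq ∷ _)     _        = inj₁ (<-trans (proj₂ vPq) q<p)
    descending (r ∷ ws) _         (inj₁ qPr ∷ walk)  (_ , nb) = inj₂ (proj₂ (ascending ws qPr walk nb))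
    descending (r ∷ ws) (_ , q<p) (inj₂ rPq ∷ walk)  (_ , nb) =
      map₁ (λ v<r → <-trans v<r q<p) (descending ws rPq walk nb)

    nonBacktracking : ∀ {p q r} ws → Unique (p ∷ q ∷ r ∷ ws) → All (_≢ v) (q ∷ r ∷ ws) →
                      NonBacktracking p q (r ∷ ws)
    nonBacktracking []       ((_ ∷ p≢r ∷ []) ∷ _) (q≢v ∷ _)  = p≢r , q≢v
    nonBacktracking (s ∷ ws) ((_ ∷ p≢r ∷ _) ∷ u)  (_ ∷ ≢v)   = p≢r , nonBacktracking ws u ≢v

  no-cycle : ∀ {R : V → V → Set} → (∀ {x y} → R x y → Step x y) → ∀ cs → ¬ IsCycle R cs
  no-cycle step (v ∷ w ∷ [])      (s≤s () , _)
  no-cycle step (v ∷ w ∷ r ∷ ws) (_ , unique@(v≢ ∷ w≢ ∷ _) , walk)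
    with nb ← nonBacktracking v ws unique (All.map ≢-sym v≢) | Linked.map step walk
  ... | inj₁ vPw ∷ walk′ = <-irrefl refl (proj₁ (ascending v (r ∷ ws) vPw walk′ nb))
  ... | inj₂ wPv ∷ walk′ with descending v (r ∷ ws) wPv walk′ nb
  ...   | inj₁ v<v = <-irrefl refl v<v
  ...   | inj₂ pPv = All-penultimate v ws w≢ (trans (proj₁ wPv) (sym (proj₁ pPv)))

module ParentGraph {n : ℕ} (par : Fin (suc n) → Fin (suc n)) (par< : ∀ i → toℕ (par (suc i)) < toℕ (suc i)) where

  open ParentRelation par toℕ public using (_ParentOf_; Step)
  open ParentRelation par toℕ using (no-cycle)

  private
    V : Set
    V = Fin (suc n)

  _parentOf?_ : ∀ x y → Dec (x ParentOf y)
  x parentOf? y = (x ≟ par y) ×-dec (suc (toℕ x) ≤? toℕ y)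

  adjacent : V → V → Bool
  adjacent x y = ⌊ x parentOf? y ⌋ ∨ ⌊ y parentOf? x ⌋

  adjacent⇒step : ∀ {x y} → adjacent x y ≡ true → Step x y
  adjacent⇒step {x} {y} h with x parentOf? y | y parentOf? x
  ... | yes xPy | _     = inj₁ xPy
  ... | no _    | yes yPx = inj₂ yPx

  parentOf⇒adjacent : ∀ {x y} → x ParentOf y → adjacent x y ≡ true
  parentOf⇒adjacent {x} {y} xPy with x parentOf? y
  ... | yes _   = refl
  ... | no ¬xPy = contradiction xPy ¬xPy

  adjacent-irrefl : ∀ x → adjacent x x ≡ false
  adjacent-irrefl x with x parentOf? x
  ... | yes (_ , x<x) = contradiction x<x (<-irrefl refl)
  ... | no _          = refl

  graph : Graph (suc n)
  graph = record
    { adj    = adjacent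
    ; sym    = λ x y → ∨-comm ⌊ x parentOf? y ⌋ ⌊ y parentOf? x ⌋
    ; irrefl = adjacent-irrefl
    }

  walk-to-root : ∀ c → Acc Fin._<_ c → Star (Adj graph) c zero
  walk-to-root zero    _        = ε
  walk-to-root (suc i) (acc rs) =
    Adj-sym graph {par (suc i)} (parentOf⇒adjacent (refl , par< i)) ◅ walk-to-root (par (suc i)) (rs (par< i))

  connected : Connected graph
  connected u v =
    walk-to-root u (<-wellFounded u) ◅◅ reverse (λ {x} {y} → Adj-sym graph {x} {y}) (walk-to-root v (<-wellFounded v))

  spanningTree : Tree graph
  spanningTree = record
    { vs      = ⊤
    ; es      = adjacent
    ; es-sym  = Graph.sym graph
    ; es-sub  = λ _ _ h → h
    ; es-ends = λ _ _ _ → ∈⊤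
    ; conn    = λ u v _ _ → connected u v
    ; acyclic = no-cycle adjacent⇒step
    }

  larger : V → V → V
  larger x y = fromℕ< (⊔-lub (toℕ<n x) (toℕ<n y))

  toℕ-larger : ∀ x y → toℕ (larger x y) ≡ toℕ x ⊔ toℕ y
  toℕ-larger x y = toℕ-fromℕ< (⊔-lub (toℕ<n x) (toℕ<n y))

  larger-comm : ∀ x y → larger x y ≡ larger y x
  larger-comm x y = toℕ-injective (trans (toℕ-larger x y) (trans (⊔-comm (toℕ x) (toℕ y)) (sym (toℕ-larger y x))))

  larger-parentOf : ∀ {x y} → x ParentOf y → larger x y ≡ y
  larger-parentOf {x} {y} (_ , x<y) = toℕ-injective (trans (toℕ-larger x y) (m≤n⇒m⊔n≡n (≤-trans (n≤1+n (toℕ x)) x<y)))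

  -- Each edge is coloured by its endpoint farther from the root.
  childColouring : ∀ {m} → (V → Fin m) → EdgeColoring graph m
  childColouring f = record { col = λ x y → f (larger x y) ; col-sym = λ x y → cong f (larger-comm x y) }

  module _ {m} (f : V → Fin m) where

    private
      c : EdgeColoring graph m
      c = childColouring f

      recolour : ∀ {k l : Fin m} {p q} → k ≡ l → k ≡ f p → l ≡ f q → f p ≡ f q
      recolour k≡l k≡fp l≡fq = trans (sym k≡fp) (trans k≡l l≡fq)

    colour-down : ∀ {x y} → x ParentOf y → col c x y ≡ f y
    colour-down xPy = cong f (larger-parentOf xPy)

    colour-up : ∀ {x y} → x ParentOf y → col c y x ≡ f y
    colour-up {x} {y} xPy = trans (col-sym c y x) (colour-down xPy)

    childColouring-proper : (∀ {x y z} → x ParentOf y → y ParentOf z → f y ≢ f z) →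
                            (∀ {x y z} → x ParentOf y → x ParentOf z → y ≢ z → f y ≢ f z) →
                            IsProperTree c spanningTree
    childColouring-proper chain siblings u v w uv vw u≢w with adjacent⇒step uv | adjacent⇒step vw
    ... | inj₁ uPv | inj₁ vPw = subst₂ _≢_ (sym (colour-down uPv)) (sym (colour-down vPw)) (chain uPv vPw)
    ... | inj₁ uPv | inj₂ wPv = contradiction (trans (proj₁ uPv) (sym (proj₁ wPv))) u≢w
    ... | inj₂ vPu | inj₁ vPw = subst₂ _≢_ (sym (colour-up vPu)) (sym (colour-down vPw)) (siblings vPu vPw u≢w)
    ... | inj₂ vPu | inj₂ wPv = subst₂ _≢_ (sym (colour-up vPu)) (sym (colour-up wPv)) (≢-sym (chain wPv vPu))

    childColouring-rainbow : (∀ {x y x′ y′} → x ParentOf y → x′ ParentOf y′ → f y ≡ f y′ → y ≡ y′) →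
                             IsRainbowTree c spanningTree
    childColouring-rainbow injective u v x y uv xy ¬same same-colour
      with adjacent⇒step uv | adjacent⇒step xy
    ... | inj₁ uPv | inj₁ xPy
      with refl ← injective {u} {v} {x} {y} uPv xPy (recolour same-colour (colour-down uPv) (colour-down xPy))
      = ¬same (inj₁ (trans (proj₁ uPv) (sym (proj₁ xPy)) , refl))
    ... | inj₁ uPv | inj₂ yPx
      with refl ← injective {u} {v} {y} {x} uPv yPx (recolour same-colour (colour-down uPv) (colour-up yPx))
      = ¬same (inj₂ (trans (proj₁ uPv) (sym (proj₁ yPx)) , refl))
    ... | inj₂ vPu | inj₁ xPy
      with refl ← injective {v} {u} {x} {y} vPu xPy (recolour same-colour (colour-up vPu) (colour-down xPy))
      = ¬same (inj₂ (refl , trans (proj₁ vPu) (sym (proj₁ xPy))))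
    ... | inj₂ vPu | inj₂ yPx
      with refl ← injective {v} {u} {y} {x} vPu yPx (recolour same-colour (colour-up vPu) (colour-up yPx))
      = ¬same (inj₁ (refl , trans (proj₁ vPu) (sym (proj₁ yPx))))

  parentEdges-distinct : ∀ {i j} → i ≢ j → ¬ SameEdge (par (suc i)) (suc i) (par (suc j)) (suc j)
  parentEdges-distinct i≢j (inj₁ (_ , i≡j)) = i≢j (suc-injective i≡j)
  parentEdges-distinct {i} {j} _ (inj₂ (pi≡j , i≡pj)) =
    <-asym (subst (λ z → toℕ z < toℕ (suc i)) pi≡j (par< i)) (subst (λ z → toℕ z < toℕ (suc j)) (sym i≡pj) (par< j))

  spanning-proper⇒kProper : ∀ {m} (c : EdgeColoring graph m) → IsProperTree c spanningTree →
                            ∀ k → IsKProper k graph c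
  spanning-proper⇒kProper c proper k S _ = spanningTree , ⊆⊤ , proper

  spanning-rainbow⇒kRainbow : ∀ {m} (c : EdgeColoring graph m) → IsRainbowTree c spanningTree →
                              ∀ k → IsKRainbow k graph c
  spanning-rainbow⇒kRainbow c rainbow k S _ = spanningTree , ⊆⊤ , rainbow

module Spider (a b : ℕ) (2≤a : 2 ≤ a) (a≤b : a ≤ b) where

  private
    V : Set
    V = Fin (suc b)

  parent : V → V
  parent zero = zero
  parent (suc i) with toℕ i <? a
  ... | yes _ = zero
  ... | no  _ = inject₁ i

  parent-cases : ∀ c → (toℕ c ≤ a × parent c ≡ zero) ⊎ (a < toℕ c × toℕ c ≡ suc (toℕ (parent c)))
  parent-cases zero = inj₁ (z≤n , refl)
  parent-cases (suc i) with toℕ i <? a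
  ... | yes i<a = inj₁ (i<a , refl)
  ... | no  i≮a = inj₂ (s≤s (≮⇒≥ i≮a) , cong suc (sym (toℕ-inject₁ i)))

  parent< : ∀ i → toℕ (parent (suc i)) < toℕ (suc i)
  parent< i with parent-cases (suc i)
  ... | inj₁ (_ , p≡0) rewrite p≡0 = s≤s z≤n
  ... | inj₂ (_ , i≡)              = ≤-reflexive (sym i≡)

  open ParentGraph parent parent< public

  parentOf-cases : ∀ {x y} → x ParentOf y → (x ≡ zero × toℕ y ≤ a) ⊎ (a ≤ toℕ x × toℕ y ≡ suc (toℕ x))
  parentOf-cases {y = y} (refl , _) with parent-cases y
  ... | inj₁ (y≤a , p≡0) = inj₁ (p≡0 , y≤a)
  ... | inj₂ (a<y , y≡)  = inj₂ (≤-pred (subst (a <_) y≡ a<y) , y≡)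

  ¬a≤0 : ¬ a ≤ 0
  ¬a≤0 a≤0 = n≮0 (≤-trans 2≤a a≤0)

  properColourℕ : ℕ → ℕ
  properColourℕ zero    = 0
  properColourℕ (suc c) with suc c ≤? a
  ... | yes _ = c
  ... | no  _ = toggle (properColourℕ c)

  properColourℕ<a : ∀ c → properColourℕ c < a
  properColourℕ<a zero = ≤-trans (s≤s z≤n) 2≤a
  properColourℕ<a (suc c) with suc c ≤? a
  ... | yes c<a = c<a
  ... | no  _   = ≤-trans (s≤s (toggle≤1 (properColourℕ c))) 2≤a

  properColourℕ-leaf : ∀ {c} → suc c ≤ a → properColourℕ (suc c) ≡ c
  properColourℕ-leaf {c} c<a with suc c ≤? a
  ... | yes _   = refl
  ... | no  c≮a = contradiction c<a c≮a

  properColourℕ-path : ∀ {c} → a ≤ c → properColourℕ (suc c) ≡ toggle (properColourℕ c)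
  properColourℕ-path {c} a≤c with suc c ≤? a
  ... | yes c<a = contradiction (<-≤-trans c<a a≤c) (<-irrefl refl)
  ... | no  _   = refl

  properColour : V → Fin a
  properColour c = fromℕ< (properColourℕ<a (toℕ c))

  properColour-injective : ∀ {x y} → properColour x ≡ properColour y → properColourℕ (toℕ x) ≡ properColourℕ (toℕ y)
  properColour-injective {x} {y} = fromℕ<-injective _ _ (properColourℕ<a (toℕ x)) (properColourℕ<a (toℕ y))

  properColour-chain : ∀ {x y z} → x ParentOf y → y ParentOf z → properColour y ≢ properColour z
  properColour-chain {y = y} {z} (_ , x<y) yPz same with parentOf-cases yPz
  ... | inj₁ (refl , _)    = n≮0 x<y
  ... | inj₂ (a≤y , z≡1+y) = toggle-≢ (properColourℕ (toℕ y)) (begin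
    toggle (properColourℕ (toℕ y))  ≡⟨ sym (properColourℕ-path a≤y) ⟩
    properColourℕ (suc (toℕ y))     ≡⟨ cong properColourℕ (sym z≡1+y) ⟩
    properColourℕ (toℕ z)           ≡⟨ sym (properColour-injective {y} {z} same) ⟩
    properColourℕ (toℕ y)           ∎)
    where open ≡-Reasoning

  properColour-siblings : ∀ {x y z} → x ParentOf y → x ParentOf z → y ≢ z → properColour y ≢ properColour z
  properColour-siblings {y = zero} (_ , ())
  properColour-siblings {z = zero} _ (_ , ())
  properColour-siblings {y = suc i} {z = suc j} xPy xPz y≢z same with parentOf-cases xPy | parentOf-cases xPz
  ... | inj₁ (_ , i<a)   | inj₁ (_ , j<a)   = y≢z (cong suc (toℕ-injective (begin
    toℕ i                           ≡⟨ sym (properColourℕ-leaf i<a) ⟩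
    properColourℕ (suc (toℕ i))     ≡⟨ properColour-injective {suc i} {suc j} same ⟩
    properColourℕ (suc (toℕ j))     ≡⟨ properColourℕ-leaf j<a ⟩
    toℕ j                           ∎)))
    where open ≡-Reasoning
  ... | inj₁ (refl , _)  | inj₂ (a≤0 , _)   = ¬a≤0 a≤0
  ... | inj₂ (a≤0 , _)   | inj₁ (refl , _)  = ¬a≤0 a≤0
  ... | inj₂ (_ , i≡)    | inj₂ (_ , j≡)    = y≢z (toℕ-injective (trans i≡ (sym j≡)))

  -- The root is the far endpoint of no edge, so its colour is irrelevant.
  rainbowColour : V → Fin b
  rainbowColour zero    = fromℕ< (<-≤-trans (s≤s z≤n) (≤-trans 2≤a a≤b))
  rainbowColour (suc i) = i

  rainbowColour-injective : ∀ {x y x′ y′} → x ParentOf y → x′ ParentOf y′ → rainbowColour y ≡ rainbowColour y′ → y ≡ y′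
  rainbowColour-injective {y = zero}  (_ , ())
  rainbowColour-injective {y′ = zero} _ (_ , ())
  rainbowColour-injective {y = suc i} {y′ = suc j} _ _ i≡j = cong suc i≡j

  -- The branch below a vertex c ≠ 0: just c if c < a, and the path from c to b if a ≤ c.
  InSubtree : V → V → Set
  InSubtree c y = y ≡ c ⊎ (a ≤ toℕ c × toℕ c ≤ toℕ y)

  inSubtree? : ∀ c → Decidable (InSubtree c)
  inSubtree? c y = (y ≟ c) ⊎-dec ((a ≤? toℕ c) ×-dec (toℕ c ≤? toℕ y))

  root∉subtree : ∀ i → ¬ InSubtree (suc i) zero
  root∉subtree i (inj₁ ())
  root∉subtree i (inj₂ (_ , ()))

  subtree-closed : ∀ i {x y} → InSubtree (suc i) x → x ParentOf y → InSubtree (suc i) y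
  subtree-closed i x∈ xPy with parentOf-cases xPy
  ... | inj₁ (refl , _) = contradiction x∈ (root∉subtree i)
  subtree-closed i (inj₁ refl) _ | inj₂ (a≤x , y≡) =
    inj₂ (a≤x , subst (toℕ (suc i) ≤_) (sym y≡) (n≤1+n (toℕ (suc i))))
  subtree-closed i (inj₂ (a≤c , c≤x)) _ | inj₂ (_ , y≡) =
    inj₂ (a≤c , subst (toℕ (suc i) ≤_) (sym y≡) (m≤n⇒m≤1+n c≤x))

  subtree-parent : ∀ i {x y} → InSubtree (suc i) x → y ParentOf x → x ≢ suc i → InSubtree (suc i) y
  subtree-parent i (inj₁ x≡c) _ x≢c = contradiction x≡c x≢c
  subtree-parent i (inj₂ (a≤c , c≤x)) yPx x≢c with m≤n⇒m<n∨m≡n c≤x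
  ... | inj₂ c≡x = contradiction (toℕ-injective (sym c≡x)) x≢c
  ... | inj₁ c<x with parentOf-cases yPx
  ...   | inj₁ (_ , x≤a) = contradiction (<-≤-trans c<x (≤-trans x≤a a≤c)) (<-irrefl refl)
  ...   | inj₂ (_ , x≡)  = inj₂ (a≤c , ≤-pred (subst (toℕ (suc i) <_) x≡ c<x))

  subtree-exit : ∀ i {x y} → Step x y → InSubtree (suc i) x → ¬ InSubtree (suc i) y →
                 x ≡ suc i × y ≡ parent (suc i)
  subtree-exit i (inj₁ xPy) x∈ y∉ = contradiction (subtree-closed i x∈ xPy) y∉
  subtree-exit i {x} (inj₂ yPx) x∈ y∉ with x ≟ suc i
  ... | yes refl = refl , proj₁ yPx
  ... | no  x≢c  = contradiction (subtree-parent i x∈ yPx x≢c) y∉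

  parentEdge-in-tree : ∀ (T : Tree graph) i {x y} → x ∈ vs T → y ∈ vs T →
                       InSubtree (suc i) x → ¬ InSubtree (suc i) y → TE T (suc i) (parent (suc i))
  parentEdge-in-tree T i x∈T y∈T x∈sub y∉sub
    with u , v , uv , u∈sub , v∉sub ← crossing-step (inSubtree? (suc i)) (conn T _ _ x∈T y∈T) x∈sub y∉sub
    with refl , refl ← subtree-exit i (adjacent⇒step (es-sub T u v uv)) u∈sub v∉sub
    = uv

  leaf : Fin a → V
  leaf t = suc (inject≤ t a≤b)

  leaf≤a : ∀ t → toℕ (leaf t) ≤ a
  leaf≤a t = subst (_< a) (sym (toℕ-inject≤ t a≤b)) (toℕ<n t)

  leaf-injective : ∀ {s t} → leaf s ≡ leaf t → s ≡ t
  leaf-injective e = inject≤-injective a≤b a≤b _ _ (suc-injective e)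

  parent-leaf : ∀ t → parent (leaf t) ≡ zero
  parent-leaf t with parent-cases (leaf t)
  ... | inj₁ (_ , p≡0) = p≡0
  ... | inj₂ (a<l , _) = contradiction (<-≤-trans a<l (leaf≤a t)) (<-irrefl refl)

  leaf∉subtree : ∀ {s t} → s ≢ t → ¬ InSubtree (leaf s) (leaf t)
  leaf∉subtree s≢t (inj₁ lt≡ls) = s≢t (leaf-injective (sym lt≡ls))
  leaf∉subtree {s} {t} s≢t (inj₂ (a≤ls , ls≤lt)) =
    s≢t (leaf-injective (toℕ-injective (≤-antisym ls≤lt (≤-trans (leaf≤a t) a≤ls))))

  leafEdge-in-tree : ∀ (T : Tree graph) {s t} → s ≢ t → leaf s ∈ vs T → leaf t ∈ vs T → TE T (leaf s) zero
  leafEdge-in-tree T {s} s≢t s∈T t∈T =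
    subst (TE T (leaf s)) (parent-leaf s) (parentEdge-in-tree T (inject≤ s a≤b) s∈T t∈T (inj₁ refl) (leaf∉subtree s≢t))

  px-lower : ∀ k → 2 ≤ k → k ≤ suc b → ∀ m → m < a → ¬ Σ (EdgeColoring graph m) (IsKProper k graph)
  px-lower k 2≤k k≤n m m<a (c , proper)
    with s , t , s<t , same ← pigeonhole m<a (λ t → col c zero (leaf t))
    with S , (s∈S ∷ t∈S ∷ []) , ∣S∣≡k ← superset-of-size (leaf s ∷ leaf t ∷ []) 2≤k k≤n
    with T , S⊆T , properT ← proper S ∣S∣≡k
    = properT (leaf s) zero (leaf t)
        (leafEdge-in-tree T s≢t (S⊆T s∈S) (S⊆T t∈S))
        (TE-sym T (leafEdge-in-tree T (≢-sym s≢t) (S⊆T t∈S) (S⊆T s∈S)))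
        (s≢t ∘ leaf-injective)
        (trans (col-sym c (leaf s) zero) same)
    where
    s≢t : s ≢ t
    s≢t = <⇒≢ s<t

  rx-lower : ∀ k → 3 ≤ k → k ≤ suc b → ∀ m → m < b → ¬ Σ (EdgeColoring graph m) (IsKRainbow k graph)
  rx-lower k 3≤k k≤n m m<b (c , rainbow)
    with i , j , i<j , same ← pigeonhole m<b (λ i → col c (parent (suc i)) (suc i))
    with S , (0∈S ∷ i∈S ∷ j∈S ∷ []) , ∣S∣≡k ← superset-of-size (zero ∷ suc i ∷ suc j ∷ []) 3≤k k≤n
    with T , S⊆T , rainbowT ← rainbow S ∣S∣≡k
    = rainbowT (parent (suc i)) (suc i) (parent (suc j)) (suc j)
        (TE-sym T (parentEdge-in-tree T i (S⊆T i∈S) (S⊆T 0∈S) (inj₁ refl) (root∉subtree i)))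
        (TE-sym T (parentEdge-in-tree T j (S⊆T j∈S) (S⊆T 0∈S) (inj₁ refl) (root∉subtree j)))
        (parentEdges-distinct (<⇒≢ i<j))
        same

  px≡a : ∀ k → 2 ≤ k → k ≤ suc b → PxEq k graph a
  px≡a k 2≤k k≤n = (c , spanning-proper⇒kProper c proper k) , px-lower k 2≤k k≤n
    where
    c : EdgeColoring graph a
    c = childColouring properColour
    proper : IsProperTree c spanningTree
    proper = childColouring-proper properColour properColour-chain properColour-siblings

  rx≡b : ∀ k → 3 ≤ k → k ≤ suc b → RxEq k graph b
  rx≡b k 3≤k k≤n = (c , spanning-rainbow⇒kRainbow c rainbow k) , rx-lower k 3≤k k≤n
    where
    c : EdgeColoring graph b
    c = childColouring rainbowColour
    rainbow : IsRainbowTree c spanningTree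
    rainbow = childColouring-rainbow rainbowColour rainbowColour-injective

theorem3p7 : ∀ (a b : ℕ) → 2 ≤ a → a ≤ b →
    Σ ℕ λ n → 3 ≤ n × Σ (Graph n) λ G → Connected G ×
      (∀ (k : ℕ) → 3 ≤ k → k ≤ n → PxEq k G a × RxEq k G b)
theorem3p7 a b 2≤a a≤b =
  suc b , s≤s (≤-trans 2≤a a≤b) , graph , connected ,
  λ k 3≤k k≤n → px≡a k (≤-trans (n≤1+n 2) 3≤k) k≤n , rx≡b k 3≤k k≤n
  where open Spider a b 2≤a a≤b
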